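{- Let $k\ge 2$ and $0\le \ell\le k-1$ be integers. Let $M$ be an $n\times n$ matrix over $\mathbb{Z}$ with $M^T=-M$ and $MM^T=mI_n$, where $m+\ell^2\equiv -1 \pmod k$. Let $C_{2n,k}(M)$ be the $\mathbb{Z}_k$-code of length $2n$ generated by the rows of $(I_n\ \ M+\ell I_n)$, with entries regarded as elements of $\mathbb{Z}_k$. Let $a,b,c,d$ be integers with $b\equiv c-\ell d \pmod k$ and $d\equiv a+\ell b\pmod k$. Then $C_{2n,k}(M)$ is self-dual, and the $2n$ rows of the matrix $$F(M)=\frac{1}{\sqrt{k}}\begin{pmatrix} aI_n+bM & cI_n+dM\\ -cI_n+dM & aI_n-bM\end{pmatrix}$$ form a $\frac{1}{k}(a^2+mb^2+c^2+md^2)$-frame in the unimodular lattice $A_k(C_{2n,k}(M))$.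
   Context: $\mathbb{Z}_k=\{0,1,\dots,k-1\}$ is the ring of integers modulo $k$. A $\mathbb{Z}_k$-code of length $N$ is a $\mathbb{Z}_k$-submodule of $\mathbb{Z}_k^N$; it is self-dual if $C=C^\perp=\{x\in\mathbb{Z}_k^N: x\cdot y=0 \text{ for all } y\in C\}$ (standard inner product). Construction A: $A_k(C)=\frac{1}{\sqrt{k}}\{x\in\mathbb{Z}^N : (x_1 \bmod k,\dots,x_N\bmod k)\in C\}$, which is a unimodular lattice when $C$ is self-dual. A $t$-frame of a lattice of dimension $N$ is a set of $N$ vectors $f_1,\dots,f_N$ in the lattice with $(f_i,f_j)=t\delta_{i,j}$. -}

module Defs where

open import Data.Nat as ℕ using (ℕ; zero; suc; NonZero)
open import Data.Integer as ℤ using (ℤ; +_; -_; _+_; _*_; _-_)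
open import Data.Integer.Divisibility using (_∣_)
open import Data.Fin using (Fin; zero; suc; splitAt)
open import Data.Sum using (inj₁; inj₂)
open import Data.Product using (Σ; _×_; _,_)
open import Data.Rational as ℚ using (ℚ)
open import Relation.Binary.PropositionalEquality using (_≡_; _≢_)

-- Vectors of length N with integer entries; an element of (ℤ_k)^N is
-- represented by an integer vector, equality in ℤ_k being congruence mod k.
Vec : ℕ → Set
Vec N = Fin N → ℤ

Mat : ℕ → ℕ → Set
Mat r s = Fin r → Fin s → ℤ

∑ : ∀ {n} → (Fin n → ℤ) → ℤ
∑ {zero}  f = + 0
∑ {suc n} f = f zero + ∑ (λ i → f (suc i))

_·_ : ∀ {N} → Vec N → Vec N → ℤ
x · y = ∑ (λ i → x i * y i)

infix 4 _≡_[mod_]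
_≡_[mod_] : ℤ → ℤ → ℕ → Set
x ≡ y [mod k ] = (+ k) ∣ (x - y)

_≐_ : ∀ {r s} → Mat r s → Mat r s → Set
A ≐ B = ∀ i j → A i j ≡ B i j

infix 4 _≐_

I : ∀ {n} → Mat n n
I zero    zero    = + 1
I zero    (suc j) = + 0
I (suc i) zero    = + 0
I (suc i) (suc j) = I i j

transpose : ∀ {r s} → Mat r s → Mat s r
transpose A i j = A j i

_⊗_ : ∀ {r s t} → Mat r s → Mat s t → Mat r t
(A ⊗ B) i j = ∑ (λ l → A i l * B l j)

_•_ : ∀ {r s} → ℤ → Mat r s → Mat r s
(c • A) i j = c * A i j

_⊞_ : ∀ {r s} → Mat r s → Mat r s → Mat r s
(A ⊞ B) i j = A i j + B i j

⊟ : ∀ {r s} → Mat r s → Mat r s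
⊟ A i j = - A i j

hblock : ∀ {r s t} → Mat r s → Mat r t → Mat r (s ℕ.+ t)
hblock {s = s} A B i j with splitAt s j
... | inj₁ j' = A i j'
... | inj₂ j' = B i j'

block : ∀ {n} → Mat n n → Mat n n → Mat n n → Mat n n → Mat (n ℕ.+ n) (n ℕ.+ n)
block {n} A B C D i with splitAt n i
... | inj₁ i' = hblock A B i'
... | inj₂ i' = hblock C D i'

Code : ℕ → Set₁
Code N = Vec N → Set

generated : (k : ℕ) {r N : ℕ} → Mat r N → Code N
generated k {r} G x = Σ (Vec r) λ λs → ∀ j → x j ≡ ∑ (λ i → λs i * G i j) [mod k ]

dual : (k : ℕ) {N : ℕ} → Code N → Code N
dual k C y = ∀ x → C x → (x · y) ≡ + 0 [mod k ]

SelfDual : (k : ℕ) {N : ℕ} → Code N → Set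
SelfDual k C = ∀ y → (C y → dual k C y) × (dual k C y → C y)

-- Construction A: the real vector (1/√k)·x (x ∈ ℤ^N) lies in A_k(C)
-- iff (x mod k) ∈ C. Points of A_k(C) are represented by such x.
InConstrA : (k : ℕ) {N : ℕ} → Code N → Vec N → Set
InConstrA k C x = C x

-- inner product of the points (1/√k)x and (1/√k)y : (x·y)/k ∈ ℚ
scaledInner : (k : ℕ) .{{_ : NonZero k}} {N : ℕ} → Vec N → Vec N → ℚ
scaledInner k x y = (x · y) ℚ./ k

IsFrameConstrA : (k : ℕ) .{{_ : NonZero k}} {N : ℕ} → Code N → ℚ → (Fin N → Vec N) → Set
IsFrameConstrA k C t f =
  (∀ i → InConstrA k C (f i)) ×
  (∀ i j → (i ≡ j → scaledInner k (f i) (f j) ≡ t) × (i ≢ j → scaledInner k (f i) (f j) ≡ ℚ.0ℚ))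

C2nk : (k : ℕ) {n : ℕ} → Mat n n → ℕ → Code (n ℕ.+ n)
C2nk k M ℓ = generated k (hblock I (M ⊞ ((+ ℓ) • I)))

-- √k · F(M)
Fmat : ∀ {n} → Mat n n → ℤ → ℤ → ℤ → ℤ → Mat (n ℕ.+ n) (n ℕ.+ n)
Fmat M a b c d =
  block ((a • I) ⊞ (b • M))       ((c • I) ⊞ (d • M))
        ((( - c) • I) ⊞ (d • M))  ((a • I) ⊞ (( - b) • M))

-- The proof is an exercise in the commutative algebra ℤ[M] ⊆ Mat_n(ℤ) spanned
-- by I and M.  Skew-symmetry and M Mᵀ = m I give M² = -m I, so matrices
-- αI + βM multiply like the complex numbers α + β√-m, and transposition is
-- conjugation.
--     With N = M + ℓI, N Nᵀ = Nᵀ N = (ℓ² + m) I, F(M) F(M)ᵀ = (a²+mb²+c²+md²) I,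
--     and the congruences on a, b, c, d put the rows of F(M) in C_{2n,k}(M).
module Submission where

open import Defs
open import Data.Nat as ℕ using (ℕ; NonZero; _≤_; _<_)
open import Data.Integer as ℤ using (ℤ; +_; -_; _+_; _*_; _-_)
open import Data.Rational as ℚ using (ℚ)
open import Data.Product using (_×_)
open import Relation.Binary.PropositionalEquality using (_≡_)

open import Data.Nat using (zero; suc)
open import Data.Fin using (Fin; zero; suc; splitAt; _↑ˡ_; _↑ʳ_)
open import Data.Fin.Properties using (splitAt-↑ˡ; splitAt-↑ʳ; join-splitAt)
open import Data.Sum using (inj₁; inj₂)
open import Data.Product using (_,_)
open import Data.List using (_∷_; [])
open import Data.Empty using (⊥-elim)
open import Function using (_∘_)
open import Relation.Nullary using (¬_)
open import Relation.Binary.Bundles using (Setoid)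
open import Relation.Binary.PropositionalEquality
  using (refl; sym; trans; cong; cong₂; subst; _≗_; module ≡-Reasoning)
import Relation.Binary.Reasoning.Setoid as SetoidReasoning
import Data.Integer.Properties as ℤP
import Data.Integer.Divisibility.Signed as Signed
open import Data.Integer.Tactic.RingSolver using (solve-∀; solve)
open import Data.Rational.Properties using (0/n≡0)
open import Algebra.Properties.Semiring.Sum ℤP.+-*-semiring as Sum using (sum)

-- The sum ∑ of Defs is the library's semiring sum, so its laws are inherited.
∑≡sum : ∀ {n} (f : Fin n → ℤ) → ∑ f ≡ sum f
∑≡sum {zero}  f = refl
∑≡sum {suc n} f = cong (λ s → f zero + s) (∑≡sum (f ∘ suc))

∑-cong : ∀ {n} {f g : Fin n → ℤ} → f ≗ g → ∑ f ≡ ∑ g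
∑-cong {f = f} {g} f≗g = trans (∑≡sum f) (trans (Sum.sum-cong-≗ f≗g) (sym (∑≡sum g)))

∑-zero : ∀ n → ∑ {n} (λ _ → + 0) ≡ + 0
∑-zero n = trans (∑≡sum {n} (λ _ → + 0)) (Sum.sum-replicate-zero n)

∑-+ : ∀ {n} (f g : Fin n → ℤ) → ∑ (λ i → f i + g i) ≡ ∑ f + ∑ g
∑-+ f g = begin
  ∑ (λ i → f i + g i)  ≡⟨ ∑≡sum (λ i → f i + g i) ⟩
  sum (λ i → f i + g i) ≡⟨ Sum.∑-distrib-+ f g ⟩
  sum f + sum g        ≡⟨ sym (cong₂ _+_ (∑≡sum f) (∑≡sum g)) ⟩
  ∑ f + ∑ g            ∎
  where open ≡-Reasoning

∑-scaleˡ : ∀ {n} c (f : Fin n → ℤ) → ∑ (λ i → c * f i) ≡ c * ∑ f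
∑-scaleˡ c f = begin
  ∑ (λ i → c * f i)   ≡⟨ ∑≡sum (λ i → c * f i) ⟩
  sum (λ i → c * f i) ≡⟨ Sum.*-distribˡ-sum c f ⟨
  c * sum f           ≡⟨ cong (c *_) (∑≡sum f) ⟨
  c * ∑ f             ∎
  where open ≡-Reasoning

∑-scaleʳ : ∀ {n} c (f : Fin n → ℤ) → ∑ (λ i → f i * c) ≡ ∑ f * c
∑-scaleʳ c f = begin
  ∑ (λ i → f i * c)   ≡⟨ ∑≡sum (λ i → f i * c) ⟩
  sum (λ i → f i * c) ≡⟨ Sum.*-distribʳ-sum c f ⟨
  sum f * c           ≡⟨ cong (_* c) (∑≡sum f) ⟨
  ∑ f * c             ∎
  where open ≡-Reasoning

∑-linear : ∀ {n} α β (f g : Fin n → ℤ) →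
           ∑ (λ i → α * f i + β * g i) ≡ α * ∑ f + β * ∑ g
∑-linear α β f g = trans (∑-+ (λ i → α * f i) (λ i → β * g i)) (cong₂ _+_ (∑-scaleˡ α f) (∑-scaleˡ β g))

∑-comm : ∀ {m n} (f : Fin m → Fin n → ℤ) →
         ∑ (λ i → ∑ (f i)) ≡ ∑ (λ j → ∑ (λ i → f i j))
∑-comm f = begin
  ∑ (λ i → ∑ (f i))                ≡⟨ ∑≡sum (λ i → ∑ (f i)) ⟩
  sum (λ i → ∑ (f i))              ≡⟨ Sum.sum-cong-≗ (λ i → ∑≡sum (f i)) ⟩
  sum (λ i → sum (f i))            ≡⟨ Sum.∑-comm f ⟩
  sum (λ j → sum (λ i → f i j))    ≡⟨ Sum.sum-cong-≗ (λ j → ∑≡sum (λ i → f i j)) ⟨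
  sum (λ j → ∑ (λ i → f i j))      ≡⟨ ∑≡sum (λ j → ∑ (λ i → f i j)) ⟨
  ∑ (λ j → ∑ (λ i → f i j))        ∎
  where open ≡-Reasoning

∑-split : ∀ {m n} (f : Fin (m ℕ.+ n) → ℤ) →
          ∑ f ≡ ∑ (λ i → f (i ↑ˡ n)) + ∑ (λ j → f (m ↑ʳ j))
∑-split {zero}  f = sym (ℤP.+-identityˡ _)
∑-split {suc m} {n} f = trans (cong (λ s → f zero + s) (∑-split {m} {n} (f ∘ suc))) (sym (ℤP.+-assoc (f zero) _ _))

∑-neg : ∀ {n} (f : Fin n → ℤ) → ∑ (λ i → - f i) ≡ - ∑ f
∑-neg f = begin
  ∑ (λ i → - f i)        ≡⟨ ∑-cong (λ i → ℤP.-1*i≡-i (f i)) ⟨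
  ∑ (λ i → - + 1 * f i)  ≡⟨ ∑-scaleˡ (- + 1) f ⟩
  - + 1 * ∑ f            ≡⟨ ℤP.-1*i≡-i (∑ f) ⟩
  - ∑ f                  ∎
  where open ≡-Reasoning

I-sym : ∀ {n} (i j : Fin n) → I i j ≡ I j i
I-sym zero    zero    = refl
I-sym zero    (suc j) = refl
I-sym (suc i) zero    = refl
I-sym (suc i) (suc j) = I-sym i j

I-diag : ∀ {n} (i : Fin n) → I i i ≡ + 1
I-diag zero    = refl
I-diag (suc i) = I-diag i

I-off : ∀ {n} (i j : Fin n) → ¬ (i ≡ j) → I i j ≡ + 0
I-off zero    zero    i≢j = ⊥-elim (i≢j refl)
I-off zero    (suc j) i≢j = refl
I-off (suc i) zero    i≢j = refl
I-off (suc i) (suc j) i≢j = I-off i j (i≢j ∘ cong suc)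

I-sumˡ : ∀ {n} (i : Fin n) (f : Vec n) → ∑ (λ l → I i l * f l) ≡ f i
I-sumˡ {suc n} zero f = begin
  + 1 * f zero + ∑ (λ l → + 0 * f (suc l))
    ≡⟨ cong₂ _+_ (ℤP.*-identityˡ (f zero)) (trans (∑-scaleˡ (+ 0) (f ∘ suc)) (ℤP.*-zeroˡ (∑ (f ∘ suc)))) ⟩
  f zero + + 0
    ≡⟨ ℤP.+-identityʳ (f zero) ⟩
  f zero ∎
  where open ≡-Reasoning
I-sumˡ {suc n} (suc i) f = trans (ℤP.+-identityˡ _) (I-sumˡ i (f ∘ suc))

I-sumʳ : ∀ {n} (f : Vec n) (j : Fin n) → ∑ (λ l → f l * I l j) ≡ f j
I-sumʳ f j = trans (∑-cong (λ l → trans (ℤP.*-comm (f l) (I l j)) (cong (_* f l) (I-sym l j))))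
                   (I-sumˡ j f)

I-↑ˡ↑ˡ : ∀ {m n} (i j : Fin m) → I (i ↑ˡ n) (j ↑ˡ n) ≡ I i j
I-↑ˡ↑ˡ zero    zero    = refl
I-↑ˡ↑ˡ zero    (suc j) = refl
I-↑ˡ↑ˡ (suc i) zero    = refl
I-↑ˡ↑ˡ (suc i) (suc j) = I-↑ˡ↑ˡ i j

I-↑ˡ↑ʳ : ∀ {m n} (i : Fin m) (j : Fin n) → I (i ↑ˡ n) (m ↑ʳ j) ≡ + 0
I-↑ˡ↑ʳ zero    j = refl
I-↑ˡ↑ʳ (suc i) j = I-↑ˡ↑ʳ i j

I-↑ʳ↑ˡ : ∀ {m n} (i : Fin n) (j : Fin m) → I (m ↑ʳ i) (j ↑ˡ n) ≡ + 0
I-↑ʳ↑ˡ {m} {n} i j = trans (I-sym (m ↑ʳ i) (j ↑ˡ n)) (I-↑ˡ↑ʳ j i)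

I-↑ʳ↑ʳ : ∀ m {n} (i j : Fin n) → I (m ↑ʳ i) (m ↑ʳ j) ≡ I i j
I-↑ʳ↑ʳ zero    i j = refl
I-↑ʳ↑ʳ (suc m) i j = I-↑ʳ↑ʳ m i j

infixl 7 _⊙_
_⊙_ : ∀ {r s} → Vec r → Mat r s → Vec s
(x ⊙ A) j = ∑ (λ i → x i * A i j)

·-comm : ∀ {N} (x y : Vec N) → x · y ≡ y · x
·-comm x y = ∑-cong (λ i → ℤP.*-comm (x i) (y i))

-- Adjointness (x A) · z = x · (A z): both sides are ∑ᵢ ∑ⱼ xᵢ Aᵢⱼ zⱼ.
⊙-· : ∀ {r s} (x : Vec r) (A : Mat r s) (z : Vec s) → (x ⊙ A) · z ≡ x · (λ i → A i · z)
⊙-· x A z = begin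
  ∑ (λ j → ∑ (λ i → x i * A i j) * z j)    ≡⟨ ∑-cong (λ j → ∑-scaleʳ (z j) (λ i → x i * A i j)) ⟨
  ∑ (λ j → ∑ (λ i → x i * A i j * z j))    ≡⟨ ∑-comm (λ i j → x i * A i j * z j) ⟨
  ∑ (λ i → ∑ (λ j → x i * A i j * z j))    ≡⟨ ∑-cong (λ i → trans (∑-cong (λ j → ℤP.*-assoc (x i) (A i j) (z j)))
                                                                  (∑-scaleˡ (x i) (λ j → A i j * z j))) ⟩
  ∑ (λ i → x i * ∑ (λ j → A i j * z j))    ∎
  where open ≡-Reasoning

-- (x A) B = x (A B): the case z = a column of B of the adjointness above.
⊙-assoc : ∀ {r s t} (x : Vec r) (A : Mat r s) (B : Mat s t) → (x ⊙ A) ⊙ B ≗ x ⊙ (A ⊗ B)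
⊙-assoc x A B j = ⊙-· x A (λ l → B l j)

⊙-scalar : ∀ {n} (x : Vec n) s (j : Fin n) → (x ⊙ (s • I)) j ≡ s * x j
⊙-scalar x s j = begin
  ∑ (λ l → x l * (s * I l j))   ≡⟨ ∑-cong (λ l → exchange (x l) s (I l j)) ⟩
  ∑ (λ l → s * (x l * I l j))   ≡⟨ ∑-scaleˡ s (λ l → x l * I l j) ⟩
  s * ∑ (λ l → x l * I l j)     ≡⟨ cong (s *_) (I-sumʳ x j) ⟩
  s * x j                       ∎
  where
  open ≡-Reasoning
  exchange : ∀ u v w → u * (v * w) ≡ v * (u * w)
  exchange = solve-∀

⊗-cong : ∀ {r s t} {A A′ : Mat r s} {B B′ : Mat s t} → A ≐ A′ → B ≐ B′ → A ⊗ B ≐ A′ ⊗ B′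
⊗-cong A≐A′ B≐B′ i j = ∑-cong (λ l → cong₂ _*_ (A≐A′ i l) (B≐B′ l j))

data Split (m n : ℕ) : Fin (m ℕ.+ n) → Set where
  top    : ∀ i → Split m n (i ↑ˡ n)
  bottom : ∀ j → Split m n (m ↑ʳ j)

split : ∀ m n p → Split m n p
split m n p with splitAt m p | join-splitAt m n p
... | inj₁ i | refl = top i
... | inj₂ j | refl = bottom j

record Halves {m n} (v : Vec (m ℕ.+ n)) (x : Vec m) (y : Vec n) : Set where
  field
    left  : ∀ i → v (i ↑ˡ n) ≡ x i
    right : ∀ j → v (m ↑ʳ j) ≡ y j
open Halves

·-halves : ∀ {m n} {v w : Vec (m ℕ.+ n)} {x x′ : Vec m} {y y′ : Vec n} →
           Halves v x y → Halves w x′ y′ → v · w ≡ x · x′ + y · y′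
·-halves {m} {n} {v} {w} hv hw = trans (∑-split {m} {n} (λ p → v p * w p))
  (cong₂ _+_ (∑-cong (λ i → cong₂ _*_ (left hv i) (left hw i)))
             (∑-cong (λ j → cong₂ _*_ (right hv j) (right hw j))))

hblock-halves : ∀ {r s t} (A : Mat r s) (B : Mat r t) i → Halves (hblock A B i) (A i) (B i)
hblock-halves {s = s} {t} A B i = record { left = onLeft ; right = onRight }
  where
  onLeft : ∀ j → hblock A B i (j ↑ˡ t) ≡ A i j
  onLeft j rewrite splitAt-↑ˡ s j t = refl
  onRight : ∀ j → hblock A B i (s ↑ʳ j) ≡ B i j
  onRight j rewrite splitAt-↑ʳ s t j = refl

⊙-hblock : ∀ {r s t} (x : Vec r) (A : Mat r s) (B : Mat r t) → Halves (x ⊙ hblock A B) (x ⊙ A) (x ⊙ B)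
⊙-hblock x A B = record
  { left  = λ j → ∑-cong (λ i → cong (x i *_) (left (hblock-halves A B i) j))
  ; right = λ j → ∑-cong (λ i → cong (x i *_) (right (hblock-halves A B i) j)) }

block-top : ∀ {n} (A B C D : Mat n n) i → Halves (block A B C D (i ↑ˡ n)) (A i) (B i)
block-top {n} A B C D i rewrite splitAt-↑ˡ n i n = hblock-halves A B i

block-bottom : ∀ {n} (A B C D : Mat n n) i → Halves (block A B C D (n ↑ʳ i)) (C i) (D i)
block-bottom {n} A B C D i rewrite splitAt-↑ʳ n n i = hblock-halves C D i

module Congruence (k : ℕ) where

  -- x ≈ y says k ∣ x - y.  It is a record, rather than an abbreviation of
  -- x ≡ y [mod k ], so that x and y can be inferred from x ≈ y.
  infix 4 _≈_
  record _≈_ (x y : ℤ) : Set where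
    constructor congruent
    field k∣x-y : + k Signed.∣ (x - y)
  open _≈_

  fromMod : ∀ {x y} → x ≡ y [mod k ] → x ≈ y
  fromMod x≡y = congruent (Signed.∣ᵤ⇒∣ x≡y)

  toMod : ∀ {x y} → x ≈ y → x ≡ y [mod k ]
  toMod x≈y = Signed.∣⇒∣ᵤ (k∣x-y x≈y)

  private
    via : ∀ {x y} e → x - y ≡ e → + k Signed.∣ e → x ≈ y
    via e x-y≡e k∣e = congruent (subst (Signed._∣_ (+ k)) (sym x-y≡e) k∣e)

  ≈-reflexive : ∀ {x y} → x ≡ y → x ≈ y
  ≈-reflexive {x} refl = via (+ 0) (ℤP.+-inverseʳ x) (Signed.divides (+ 0) refl)

  ≈-refl : ∀ {x} → x ≈ x
  ≈-refl = ≈-reflexive refl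

  ≈-sym : ∀ {x y} → x ≈ y → y ≈ x
  ≈-sym {x} {y} x≈y = via (- (x - y)) (solve (x ∷ y ∷ [])) (Signed.∣m⇒∣-m (k∣x-y x≈y))

  ≈-trans : ∀ {x y z} → x ≈ y → y ≈ z → x ≈ z
  ≈-trans {x} {y} {z} x≈y y≈z = via ((x - y) + (y - z)) (solve (x ∷ y ∷ z ∷ []))
    (Signed.∣m∣n⇒∣m+n (k∣x-y x≈y) (k∣x-y y≈z))

  +-cong≈ : ∀ {x x′ y y′} → x ≈ x′ → y ≈ y′ → x + y ≈ x′ + y′
  +-cong≈ {x} {x′} {y} {y′} x≈x′ y≈y′ = via ((x - x′) + (y - y′))
    (solve (x ∷ x′ ∷ y ∷ y′ ∷ [])) (Signed.∣m∣n⇒∣m+n (k∣x-y x≈x′) (k∣x-y y≈y′))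

  *-congˡ≈ : ∀ c {x y} → x ≈ y → c * x ≈ c * y
  *-congˡ≈ c {x} {y} x≈y = via (c * (x - y)) (solve (c ∷ x ∷ y ∷ []))
    (Signed.∣n⇒∣m*n c (k∣x-y x≈y))

  *-congʳ≈ : ∀ c {x y} → x ≈ y → x * c ≈ y * c
  *-congʳ≈ c {x} {y} x≈y = via ((x - y) * c) (solve (c ∷ x ∷ y ∷ []))
    (Signed.∣m⇒∣m*n c (k∣x-y x≈y))

  -‿cong≈ : ∀ {x y} → x ≈ y → - x ≈ - y
  -‿cong≈ {x} {y} x≈y = via (- (x - y)) (solve (x ∷ y ∷ []))
    (Signed.∣m⇒∣-m (k∣x-y x≈y))

  ∑-cong≈ : ∀ {n} {f g : Fin n → ℤ} → (∀ i → f i ≈ g i) → ∑ f ≈ ∑ g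
  ∑-cong≈ {zero}  f≈g = ≈-refl
  ∑-cong≈ {suc n} f≈g = +-cong≈ (f≈g zero) (∑-cong≈ (f≈g ∘ suc))

  absorb : ∀ x {u} y → u ≈ + 0 → x + u * y ≈ x
  absorb x y u≈0 = ≈-trans (+-cong≈ (≈-refl {x}) (*-congʳ≈ y u≈0)) (≈-reflexive (ℤP.+-identityʳ x))

  ≈-neg : ∀ {x y} → x + y ≈ + 0 → x ≈ - y
  ≈-neg {x} {y} x+y≈0 = via ((x + y) - + 0) (solve (x ∷ y ∷ [])) (k∣x-y x+y≈0)

  ≈-setoid : Setoid _ _
  ≈-setoid = record
    { Carrier = ℤ ; _≈_ = _≈_
    ; isEquivalence = record { refl = ≈-refl ; sym = ≈-sym ; trans = ≈-trans } }

  module ≈-Reasoning = SetoidReasoning ≈-setoid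

module Codes (k : ℕ) where
  open Congruence k
  open ≈-Reasoning

  row-generated : ∀ {r N} (G : Mat r N) i → generated k G (G i)
  row-generated G i = I i , λ j → toMod (≈-reflexive (sym (I-sumˡ i (λ l → G l j))))

  dual-of-generators : ∀ {r N} (G : Mat r N) y → (∀ i → G i · y ≈ + 0) → dual k (generated k G) y
  dual-of-generators {r} G y G⊥y x (λs , x≡λsG) = toMod (begin
    x · y                    ≈⟨ ∑-cong≈ (λ j → *-congʳ≈ (y j) (fromMod {x j} {(λs ⊙ G) j} (x≡λsG j))) ⟩
    (λs ⊙ G) · y             ≡⟨ ⊙-· λs G y ⟩
    λs · (λ i → G i · y)     ≈⟨ ∑-cong≈ (λ i → *-congˡ≈ (λs i) (G⊥y i)) ⟩
    ∑ (λ i → λs i * + 0)     ≡⟨ ∑-cong (λ i → ℤP.*-zeroʳ (λs i)) ⟩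
    ∑ {r} (λ _ → + 0)        ≡⟨ ∑-zero r ⟩
    + 0                      ∎)

  code⊆dual : ∀ {r N} (G : Mat r N) → (∀ i j → G i · G j ≈ + 0) →
              ∀ y → generated k G y → dual k (generated k G) y
  code⊆dual G G⊥G y y∈C = dual-of-generators G y λ i → begin
    G i · y   ≡⟨ ·-comm (G i) y ⟩
    y · G i   ≈⟨ fromMod {y · G i} (dual-of-generators G (G i) (λ j → G⊥G j i) y y∈C) ⟩
    + 0       ∎

  module Systematic {n} (N : Mat n n) where

    G : Mat n (n ℕ.+ n)
    G = hblock I N

    -- (x | y) lies in the code as soon as y ≡ x N; the coefficients are x.
    systematic∈ : ∀ {v x y} → Halves v x y → (∀ j → y j ≈ (x ⊙ N) j) → generated k G v
    systematic∈ {v} {x} {y} v=x∣y y≈xN = x , λ p → toMod (coordinate p)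
      where
      coordinate : ∀ p → v p ≈ (x ⊙ G) p
      coordinate p with split n n p
      ... | top i = begin
        v (i ↑ˡ n)          ≡⟨ left v=x∣y i ⟩
        x i                 ≡⟨ I-sumʳ x i ⟨
        (x ⊙ I) i           ≡⟨ left (⊙-hblock x I N) i ⟨
        (x ⊙ G) (i ↑ˡ n)    ∎
      ... | bottom j = begin
        v (n ↑ʳ j)          ≡⟨ right v=x∣y j ⟩
        y j                 ≈⟨ y≈xN j ⟩
        (x ⊙ N) j           ≡⟨ right (⊙-hblock x I N) j ⟨
        (x ⊙ G) (n ↑ʳ j)    ∎

    self-dual : ∀ s → N ⊗ transpose N ≐ s • I → transpose N ⊗ N ≐ s • I → s ≈ - + 1 →
                SelfDual k (generated k G)
    self-dual s NNᵀ NᵀN s≈-1 y = code⊆dual G G⊥G y , dual⊆code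
      where
      -- G Gᵀ = I + N Nᵀ = (1 + s) I ≡ 0
      G⊥G : ∀ i j → G i · G j ≈ + 0
      G⊥G i j = begin
        G i · G j               ≡⟨ ·-halves (hblock-halves I N i) (hblock-halves I N j) ⟩
        I i · I j + N i · N j   ≡⟨ cong₂ _+_ (trans (I-sumˡ i (I j)) (I-sym j i)) (NNᵀ i j) ⟩
        I i j + s * I i j       ≈⟨ +-cong≈ (≈-refl {I i j}) (*-congʳ≈ (I i j) s≈-1) ⟩
        I i j + - + 1 * I i j   ≡⟨ cong (λ t → I i j + t) (ℤP.-1*i≡-i (I i j)) ⟩
        I i j - I i j           ≡⟨ ℤP.+-inverseʳ (I i j) ⟩
        + 0                     ∎

      y₁ y₂ : Vec n
      y₁ i = y (i ↑ˡ n)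
      y₂ j = y (n ↑ʳ j)

      y=y₁∣y₂ : Halves y y₁ y₂
      y=y₁∣y₂ = record { left = λ _ → refl ; right = λ _ → refl }

      -- Orthogonality to the generator G i says y₁ i + N i · y₂ ≡ 0.
      y₁≈-Ny₂ : dual k (generated k G) y → ∀ i → y₁ i ≈ - (N i · y₂)
      y₁≈-Ny₂ y⊥C i = ≈-neg (begin
        y₁ i + N i · y₂         ≡⟨ cong (_+ N i · y₂) (I-sumˡ i y₁) ⟨
        I i · y₁ + N i · y₂     ≡⟨ ·-halves (hblock-halves I N i) y=y₁∣y₂ ⟨
        G i · y                 ≈⟨ fromMod {G i · y} (y⊥C (G i) (row-generated G i)) ⟩
        + 0                     ∎)

      -- Hence y₁ N ≡ -(y₂ Nᵀ) N = -s y₂ ≡ y₂.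
      dual⊆code : dual k (generated k G) y → generated k G y
      dual⊆code y⊥C = systematic∈ y=y₁∣y₂ λ j → ≈-sym (begin
        (y₁ ⊙ N) j                                 ≈⟨ ∑-cong≈ (λ i → *-congʳ≈ (N i j) (y₁≈-Ny₂ y⊥C i)) ⟩
        ∑ (λ i → - (N i · y₂) * N i j)             ≡⟨ ∑-cong (λ i → ℤP.neg-distribˡ-* (N i · y₂) (N i j)) ⟨
        ∑ (λ i → - (N i · y₂ * N i j))             ≡⟨ ∑-neg (λ i → N i · y₂ * N i j) ⟩
        - ∑ (λ i → N i · y₂ * N i j)               ≡⟨ cong -_ (∑-cong (λ i → cong (_* N i j) (·-comm (N i) y₂))) ⟩
        - ((y₂ ⊙ transpose N) ⊙ N) j               ≡⟨ cong -_ (⊙-assoc y₂ (transpose N) N j) ⟩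
        - (y₂ ⊙ (transpose N ⊗ N)) j               ≡⟨ cong -_ (∑-cong (λ l → cong (y₂ l *_) (NᵀN l j))) ⟩
        - (y₂ ⊙ (s • I)) j                         ≡⟨ cong -_ (⊙-scalar y₂ s j) ⟩
        - (s * y₂ j)                               ≈⟨ -‿cong≈ (*-congʳ≈ (y₂ j) s≈-1) ⟩
        - (- + 1 * y₂ j)                           ≡⟨ cong -_ (ℤP.-1*i≡-i (y₂ j)) ⟩
        - - y₂ j                                   ≡⟨ ℤP.neg-involutive (y₂ j) ⟩
        y₂ j                                       ∎)

frame-from-gram : (k : ℕ) .{{_ : NonZero k}} {N : ℕ} (C : Code N) (t : ℤ) (F : Mat N N) →
                  (∀ p → C (F p)) → (∀ p q → F p · F q ≡ t * I p q) →
                  IsFrameConstrA k C (t ℚ./ k) F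
frame-from-gram k C t F F∈C gram = F∈C , λ p q → diagonal p q , off-diagonal p q
  where
  diagonal : ∀ p q → p ≡ q → scaledInner k (F p) (F q) ≡ t ℚ./ k
  diagonal p .p refl = cong (λ z → z ℚ./ k)
    (trans (gram p p) (trans (cong (t *_) (I-diag p)) (ℤP.*-identityʳ t)))

  off-diagonal : ∀ p q → ¬ (p ≡ q) → scaledInner k (F p) (F q) ≡ ℚ.0ℚ
  off-diagonal p q p≢q = trans (cong (λ z → z ℚ./ k)
    (trans (gram p q) (trans (cong (t *_) (I-off p q p≢q)) (ℤP.*-zeroʳ t)))) (0/n≡0 k)

module SkewAlgebra {n} (M : Mat n n) (m : ℤ)
                   (skew : transpose M ≐ ⊟ M) (orth : M ⊗ transpose M ≐ m • I) where

  -- The matrix αI + βM, which behaves like the number α + β√-m.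
  elt : ℤ → ℤ → Mat n n
  elt α β = (α • I) ⊞ (β • M)

  -- M² = -M Mᵀ = -m I.
  M² : M ⊗ M ≐ (- m) • I
  M² i j = begin
    ∑ (λ l → M i l * M l j)       ≡⟨ ∑-cong (λ l → trans (cong (M i l *_) (skew j l))
                                                         (sym (ℤP.neg-distribʳ-* (M i l) (M j l)))) ⟩
    ∑ (λ l → - (M i l * M j l))   ≡⟨ ∑-neg (λ l → M i l * M j l) ⟩
    - (M ⊗ transpose M) i j       ≡⟨ cong -_ (orth i j) ⟩
    - (m * I i j)                 ≡⟨ ℤP.neg-distribˡ-* m (I i j) ⟩
    - m * I i j                   ∎
    where open ≡-Reasoning

  elt-⊙ : ∀ α β i (B : Mat n n) j → (elt α β i ⊙ B) j ≡ α * B i j + β * (M ⊗ B) i j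
  elt-⊙ α β i B j = begin
    ∑ (λ l → (α * I i l + β * M i l) * B l j)             ≡⟨ ∑-cong (λ l → distrib α β (I i l) (M i l) (B l j)) ⟩
    ∑ (λ l → α * (I i l * B l j) + β * (M i l * B l j))   ≡⟨ ∑-linear α β (λ l → I i l * B l j) (λ l → M i l * B l j) ⟩
    α * ∑ (λ l → I i l * B l j) + β * (M ⊗ B) i j         ≡⟨ cong (λ t → α * t + β * (M ⊗ B) i j) (I-sumˡ i (λ l → B l j)) ⟩
    α * B i j + β * (M ⊗ B) i j                           ∎
    where
    open ≡-Reasoning
    distrib : ∀ α β x y z → (α * x + β * y) * z ≡ α * (x * z) + β * (y * z)
    distrib = solve-∀

  ⊙-elt : ∀ (x : Vec n) γ δ j → (x ⊙ elt γ δ) j ≡ γ * x j + δ * (x ⊙ M) j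
  ⊙-elt x γ δ j = begin
    ∑ (λ l → x l * (γ * I l j + δ * M l j))           ≡⟨ ∑-cong (λ l → distrib γ δ (x l) (I l j) (M l j)) ⟩
    ∑ (λ l → γ * (x l * I l j) + δ * (x l * M l j))   ≡⟨ ∑-linear γ δ (λ l → x l * I l j) (λ l → x l * M l j) ⟩
    γ * ∑ (λ l → x l * I l j) + δ * (x ⊙ M) j         ≡⟨ cong (λ t → γ * t + δ * (x ⊙ M) j) (I-sumʳ x j) ⟩
    γ * x j + δ * (x ⊙ M) j                           ∎
    where
    open ≡-Reasoning
    distrib : ∀ γ δ x y z → x * (γ * y + δ * z) ≡ γ * (x * y) + δ * (x * z)
    distrib = solve-∀

  elt-mul : ∀ α β γ δ → elt α β ⊗ elt γ δ ≐ elt (α * γ - m * (β * δ)) (α * δ + β * γ)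
  elt-mul α β γ δ i j = begin
    (elt α β i ⊙ elt γ δ) j                                  ≡⟨ elt-⊙ α β i (elt γ δ) j ⟩
    α * elt γ δ i j + β * (M i ⊙ elt γ δ) j                  ≡⟨ cong (λ t → α * elt γ δ i j + β * t) (⊙-elt (M i) γ δ j) ⟩
    α * elt γ δ i j + β * (γ * M i j + δ * (M ⊗ M) i j)      ≡⟨ cong (λ t → α * elt γ δ i j + β * (γ * M i j + δ * t)) (M² i j) ⟩
    α * elt γ δ i j + β * (γ * M i j + δ * (- m * I i j))    ≡⟨ expand α β γ δ m (I i j) (M i j) ⟩
    elt (α * γ - m * (β * δ)) (α * δ + β * γ) i j            ∎
    where
    open ≡-Reasoning
    expand : ∀ α β γ δ m X Y → α * (γ * X + δ * Y) + β * (γ * Y + δ * (- m * X))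
                               ≡ (α * γ - m * (β * δ)) * X + (α * δ + β * γ) * Y
    expand = solve-∀

  elt-transpose : ∀ α β → transpose (elt α β) ≐ elt α (- β)
  elt-transpose α β i j = cong₂ _+_ (cong (α *_) (I-sym j i)) (begin
    β * M j i       ≡⟨ cong (β *_) (skew i j) ⟩
    β * - M i j     ≡⟨ ℤP.neg-distribʳ-* β (M i j) ⟨
    - (β * M i j)   ≡⟨ ℤP.neg-distribˡ-* β (M i j) ⟩
    - β * M i j     ∎)
    where open ≡-Reasoning

  elt-gram : ∀ α β γ δ i j → elt α β i · elt γ δ j ≡ elt (α * γ + m * (β * δ)) (β * γ - α * δ) i j
  elt-gram α β γ δ i j = begin
    (elt α β ⊗ transpose (elt γ δ)) i j                  ≡⟨ ⊗-cong {A = elt α β} (λ _ _ → refl) (elt-transpose γ δ) i j ⟩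
    (elt α β ⊗ elt γ (- δ)) i j                          ≡⟨ elt-mul α β γ (- δ) i j ⟩
    elt (α * γ - m * (β * - δ)) (α * - δ + β * γ) i j    ≡⟨ conjugate α β γ δ m (I i j) (M i j) ⟩
    elt (α * γ + m * (β * δ)) (β * γ - α * δ) i j        ∎
    where
    open ≡-Reasoning
    conjugate : ∀ α β γ δ m X Y → (α * γ - m * (β * - δ)) * X + (α * - δ + β * γ) * Y
                                  ≡ (α * γ + m * (β * δ)) * X + (β * γ - α * δ) * Y
    conjugate = solve-∀

  rows-gram : ∀ {v w} α β γ δ α′ β′ γ′ δ′ i j →
              Halves v (elt α β i) (elt γ δ i) → Halves w (elt α′ β′ j) (elt γ′ δ′ j) →
              v · w ≡ elt (α * α′ + m * (β * β′)) (β * α′ - α * β′) i j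
                    + elt (γ * γ′ + m * (δ * δ′)) (δ * γ′ - γ * δ′) i j
  rows-gram α β γ δ α′ β′ γ′ δ′ i j v-halves w-halves = trans (·-halves v-halves w-halves)
    (cong₂ _+_ (elt-gram α β α′ β′ i j) (elt-gram γ δ γ′ δ′ i j))

  module Shift (ℓ : ℤ) where

    N : Mat n n
    N = M ⊞ (ℓ • I)

    N-elt : N ≐ elt ℓ (+ 1)
    N-elt i j = reorder ℓ (M i j) (I i j)
      where
      reorder : ∀ ℓ Y X → Y + ℓ * X ≡ ℓ * X + + 1 * Y
      reorder = solve-∀

    NNᵀ : N ⊗ transpose N ≐ (ℓ * ℓ + m) • I
    NNᵀ i j = trans (⊗-cong N-elt (λ a b → N-elt b a) i j)
                    (trans (elt-gram ℓ (+ 1) ℓ (+ 1) i j) (norm ℓ m (I i j) (M i j)))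
      where
      norm : ∀ ℓ m X Y → (ℓ * ℓ + m * (+ 1 * + 1)) * X + (+ 1 * ℓ - ℓ * + 1) * Y ≡ (ℓ * ℓ + m) * X
      norm = solve-∀

    NᵀN : transpose N ⊗ N ≐ (ℓ * ℓ + m) • I
    NᵀN i j = trans (⊗-cong (λ a b → trans (N-elt b a) (elt-transpose ℓ (+ 1) a b)) N-elt i j)
                    (trans (elt-mul ℓ (- + 1) ℓ (+ 1) i j) (norm ℓ m (I i j) (M i j)))
      where
      norm : ∀ ℓ m X Y → (ℓ * ℓ - m * (- + 1 * + 1)) * X + (ℓ * + 1 + - + 1 * ℓ) * Y ≡ (ℓ * ℓ + m) * X
      norm = solve-∀

    elt-N : ∀ α β → elt α β ⊗ N ≐ elt (α * ℓ - m * β) (α + β * ℓ)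
    elt-N α β i j = trans (⊗-cong {A = elt α β} (λ _ _ → refl) N-elt i j)
                          (trans (elt-mul α β ℓ (+ 1) i j) (norm α β ℓ m (I i j) (M i j)))
      where
      norm : ∀ α β ℓ m X Y → (α * ℓ - m * (β * + 1)) * X + (α * + 1 + β * ℓ) * Y
                             ≡ (α * ℓ - m * β) * X + (α + β * ℓ) * Y
      norm = solve-∀

    module Membership (k : ℕ) where
      open Congruence k
      open Codes k
      open Systematic N

      row∈code : ∀ {v} α β γ δ i → Halves v (elt α β i) (elt γ δ i) →
                 γ ≈ α * ℓ - m * β → δ ≈ α + β * ℓ → generated k G v
      row∈code α β γ δ i v-halves γ≈ δ≈ = systematic∈ v-halves λ j → begin
        elt γ δ i j                            ≈⟨ +-cong≈ (*-congʳ≈ (I i j) γ≈) (*-congʳ≈ (M i j) δ≈) ⟩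
        elt (α * ℓ - m * β) (α + β * ℓ) i j    ≡⟨ elt-N α β i j ⟨
        (elt α β i ⊙ N) j                      ∎
        where open ≈-Reasoning

  module Frame (a b c d : ℤ) where

    F : Mat (n ℕ.+ n) (n ℕ.+ n)
    F = Fmat M a b c d

    T : ℤ
    T = a * a + m * (b * b) + c * c + m * (d * d)

    F-top : ∀ i → Halves (F (i ↑ˡ n)) (elt a b i) (elt c d i)
    F-top = block-top (elt a b) (elt c d) (elt (- c) d) (elt a (- b))

    F-bottom : ∀ i → Halves (F (n ↑ʳ i)) (elt (- c) d i) (elt a (- b) i)
    F-bottom = block-bottom (elt a b) (elt c d) (elt (- c) d) (elt a (- b))

    -- The four polynomial identities behind the Gram computation, with X, Y
    -- standing for the entries of I and M.
    private
      top-top : ∀ a b c d m X Y →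
        (a * a + m * (b * b)) * X + (b * a - a * b) * Y + ((c * c + m * (d * d)) * X + (d * c - c * d) * Y)
          ≡ (a * a + m * (b * b) + c * c + m * (d * d)) * X
      top-top = solve-∀
      bottom-bottom : ∀ a b c d m X Y →
        ((- c) * (- c) + m * (d * d)) * X + (d * (- c) - (- c) * d) * Y
          + ((a * a + m * ((- b) * (- b))) * X + ((- b) * a - a * (- b)) * Y)
          ≡ (a * a + m * (b * b) + c * c + m * (d * d)) * X
      bottom-bottom = solve-∀
      top-bottom : ∀ a b c d m X Y →
        (a * (- c) + m * (b * d)) * X + (b * (- c) - a * d) * Y
          + ((c * a + m * (d * (- b))) * X + (d * a - c * (- b)) * Y) ≡ + 0
      top-bottom = solve-∀
      bottom-top : ∀ a b c d m X Y →
        ((- c) * a + m * (d * b)) * X + (d * a - (- c) * b) * Y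
          + ((a * c + m * ((- b) * d)) * X + ((- b) * c - a * d) * Y) ≡ + 0
      bottom-top = solve-∀

    -- F Fᵀ = T I: within a block the I-coefficients add up to T and the
    -- M-coefficients cancel; across blocks both cancel.
    F-gram : ∀ p q → F p · F q ≡ T * I p q
    F-gram p q with split n n p | split n n q
    ... | top i | top j = trans (rows-gram a b c d a b c d i j (F-top i) (F-top j))
      (trans (top-top a b c d m (I i j) (M i j)) (cong (T *_) (sym (I-↑ˡ↑ˡ i j))))
    ... | bottom i | bottom j = trans (rows-gram (- c) d a (- b) (- c) d a (- b) i j (F-bottom i) (F-bottom j))
      (trans (bottom-bottom a b c d m (I i j) (M i j)) (cong (T *_) (sym (I-↑ʳ↑ʳ n i j))))
    ... | top i | bottom j = trans (rows-gram a b c d (- c) d a (- b) i j (F-top i) (F-bottom j))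
      (trans (top-bottom a b c d m (I i j) (M i j))
             (sym (trans (cong (T *_) (I-↑ˡ↑ʳ i j)) (ℤP.*-zeroʳ T))))
    ... | bottom i | top j = trans (rows-gram (- c) d a (- b) a b c d i j (F-bottom i) (F-top j))
      (trans (bottom-top a b c d m (I i j) (M i j))
             (sym (trans (cong (T *_) (I-↑ʳ↑ˡ i j)) (ℤP.*-zeroʳ T))))

-- Under m + l² ≡ -1, b ≡ c - l d and d ≡ a + l b (mod k), the top rows
-- (aI + bM | cI + dM) and the bottom rows (-cI + dM | aI - bM) of F(M)
-- satisfy the membership criterion γ ≡ αl - mβ, δ ≡ α + βl.
module Coefficients (k : ℕ) (l m a b c d : ℤ) (m+l²≡-1 : m + l * l ≡ - + 1 [mod k ])
                    (b≡c-ld : b ≡ c - l * d [mod k ]) (d≡a+lb : d ≡ a + l * b [mod k ]) where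
  open Congruence k
  open ≈-Reasoning

  private
    b≈c-ld : b ≈ c - l * d
    b≈c-ld = fromMod b≡c-ld

    d≈a+lb : d ≈ a + l * b
    d≈a+lb = fromMod d≡a+lb

    m+l²+1≈0 : m + l * l + + 1 ≈ + 0
    m+l²+1≈0 = +-cong≈ (fromMod {m + l * l} { - + 1} m+l²≡-1) (≈-refl {+ 1})

  top-c : c ≈ a * l - m * b
  top-c = begin
    c                                            ≡⟨ solve (c ∷ l ∷ d ∷ []) ⟩
    (c - l * d) + l * d                          ≈⟨ +-cong≈ (≈-sym b≈c-ld) (≈-refl {l * d}) ⟩
    b + l * d                                    ≈⟨ +-cong≈ (≈-refl {b}) (*-congˡ≈ l d≈a+lb) ⟩
    b + l * (a + l * b)                          ≡⟨ solve (a ∷ b ∷ l ∷ m ∷ []) ⟩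
    (a * l - m * b) + (m + l * l + + 1) * b      ≈⟨ absorb (a * l - m * b) b m+l²+1≈0 ⟩
    a * l - m * b                                ∎

  top-d : d ≈ a + b * l
  top-d = begin
    d            ≈⟨ d≈a+lb ⟩
    a + l * b    ≡⟨ solve (a ∷ b ∷ l ∷ []) ⟩
    a + b * l    ∎

  bottom-a : a ≈ (- c) * l - m * d
  bottom-a = begin
    a                                              ≡⟨ solve (a ∷ b ∷ l ∷ []) ⟩
    (a + l * b) - l * b                            ≈⟨ +-cong≈ (≈-sym d≈a+lb) (≈-refl { - (l * b)}) ⟩
    d - l * b                                      ≈⟨ +-cong≈ (≈-refl {d}) (-‿cong≈ (*-congˡ≈ l b≈c-ld)) ⟩
    d - l * (c - l * d)                            ≡⟨ solve (c ∷ d ∷ l ∷ m ∷ []) ⟩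
    ((- c) * l - m * d) + (m + l * l + + 1) * d    ≈⟨ absorb ((- c) * l - m * d) d m+l²+1≈0 ⟩
    (- c) * l - m * d                              ∎

  bottom-b : - b ≈ - c + d * l
  bottom-b = begin
    - b              ≈⟨ -‿cong≈ b≈c-ld ⟩
    - (c - l * d)    ≡⟨ solve (c ∷ d ∷ l ∷ []) ⟩
    - c + d * l      ∎

proposition3p1 : (k : ℕ) .{{_ : NonZero k}} → 2 ≤ k → (ℓ : ℕ) → ℓ < k →
    (n : ℕ) (M : Mat n n) (m : ℤ) →
    transpose M ≐ ⊟ M →
    M ⊗ transpose M ≐ m • I →
    m + (+ ℓ) * (+ ℓ) ≡ - (+ 1) [mod k ] →
    (a b c d : ℤ) →
    b ≡ c - (+ ℓ) * d [mod k ] →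
    d ≡ a + (+ ℓ) * b [mod k ] →
    SelfDual k (C2nk k M ℓ) ×
    IsFrameConstrA k (C2nk k M ℓ) ((a * a + m * (b * b) + c * c + m * (d * d)) ℚ./ k) (Fmat M a b c d)
proposition3p1 k _ ℓ _ n M m skew orth m+ℓ²≡-1 a b c d b≡c-ℓd d≡a+ℓb =
  self-dual (+ ℓ * + ℓ + m) NNᵀ NᵀN ℓ²+m≈-1 , frame-from-gram k (C2nk k M ℓ) T F F∈C F-gram
  where
  open Congruence k
  open SkewAlgebra M m skew orth
  open Shift (+ ℓ)
  open Membership k
  open Codes.Systematic k N
  open Frame a b c d
  open Coefficients k (+ ℓ) m a b c d m+ℓ²≡-1 b≡c-ℓd d≡a+ℓb

  ℓ²+m≈-1 : + ℓ * + ℓ + m ≈ - + 1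
  ℓ²+m≈-1 = ≈-trans (≈-reflexive (ℤP.+-comm (+ ℓ * + ℓ) m)) (fromMod m+ℓ²≡-1)

  F∈C : ∀ p → C2nk k M ℓ (F p)
  F∈C p with split n n p
  ... | top i    = row∈code a b c d i (F-top i) top-c top-d
  ... | bottom i = row∈code (- c) d a (- b) i (F-bottom i) bottom-a bottom-b
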